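{- Let $S=\{x^2-2,x^2-3\}$ and let $f\in M_S$. Then: (1) if $f(0)\equiv2\pmod4$, then $f$ is Eisenstein at the prime $p=2$; (2) if $f(0)\equiv\pm1\pmod4$, then $f(x+1)$ is Eisenstein at the prime $p=2$. In particular, every $f\in M_S$ is irreducible over $\mathbb{Q}$.
   Context: $M_S$ is the monoid generated by $S$ under composition (including the identity map $x$). -}

module Defs where

open import Data.Bool using (Bool; true; false)
open import Data.Nat using (ℕ; _∸_)
open import Data.Integer as ℤ using (ℤ; +_)
open import Data.Integer.Divisibility as ℤD using ()
open import Data.Rational as ℚ using (ℚ; _/_)
import Data.Rational.Properties as ℚP
open import Data.List using (List; []; _∷_; _++_; [_]; map; length)
open import Data.List.Relation.Unary.All using (All)
open import Data.Product using (Σ; _×_; _,_)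
open import Data.Sum using (_⊎_)
open import Relation.Nullary using (¬_; Dec; yes; no)
open import Relation.Binary.PropositionalEquality using (_≡_)

-- Univariate polynomials over a commutative ring A, represented by their
-- coefficient lists, lowest degree first: a₀ ∷ a₁ ∷ … ∷ aₙ ∷ [] = Σ aᵢ xⁱ.
-- Trailing zero coefficients are allowed; 'normalize' removes them.
module PolyOps {A : Set} (0# 1# : A) (_+_ _*_ : A → A → A)
               (isZero? : (a : A) → Dec (a ≡ 0#)) where

  Poly : Set
  Poly = List A

  addP : Poly → Poly → Poly
  addP [] q = q
  addP (a ∷ p) [] = a ∷ p
  addP (a ∷ p) (b ∷ q) = (a + b) ∷ addP p q

  scaleP : A → Poly → Poly
  scaleP a = map (a *_)

  mulP : Poly → Poly → Poly
  mulP [] q = []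
  mulP (a ∷ p) q = addP (scaleP a q) (0# ∷ mulP p q)

  compP : Poly → Poly → Poly
  compP [] q = []
  compP (a ∷ p) q = addP [ a ] (mulP q (compP p q))

  X : Poly
  X = 0# ∷ 1# ∷ []

  normalize : Poly → Poly
  normalize [] = []
  normalize (a ∷ p) with normalize p
  ... | b ∷ r = a ∷ b ∷ r
  ... | [] with isZero? a
  ...   | yes _ = []
  ...   | no _ = a ∷ []

  -- degree (the zero polynomial is given degree 0 here; only used for
  -- nonzero polynomials)
  deg : Poly → ℕ
  deg p = length (normalize p) ∸ 1

  at0 : Poly → A
  at0 [] = 0#
  at0 (a ∷ _) = a

module ℤPoly = PolyOps (+ 0) (+ 1) ℤ._+_ ℤ._*_ (λ a → a ℤ.≟ + 0)
open ℤPoly public using (Poly; addP; mulP; compP; normalize; deg; at0)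
  renaming (X to Xℤ)

s₂ s₃ : Poly
s₂ = ℤ.- (+ 2) ∷ + 0 ∷ + 1 ∷ []
s₃ = ℤ.- (+ 3) ∷ + 0 ∷ + 1 ∷ []

gen : Bool → Poly
gen true  = s₂
gen false = s₃

-- M_S: the monoid generated by S under composition, including the identity x.
-- Its elements are exactly the compositions g₁ ∘ g₂ ∘ … ∘ gₖ (k ≥ 0) of
-- generators; the empty composition is x.
data InMS : Poly → Set where
  idMS   : InMS Xℤ
  compMS : (b : Bool) {f : Poly} → InMS f → InMS (compP (gen b) f)

shift1 : Poly → Poly
shift1 f = compP f (+ 1 ∷ + 1 ∷ [])

Eisenstein : ℤ → Poly → Set
Eisenstein p f =
  Σ ℤ λ a₀ → Σ (List ℤ) λ as → Σ ℤ λ aₙ →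
    (normalize f ≡ (a₀ ∷ as) ++ [ aₙ ]) ×
    (¬ (p ℤD.∣ aₙ)) × (p ℤD.∣ a₀) × All (p ℤD.∣_) as × (¬ ((p ℤ.* p) ℤD.∣ a₀))

module ℚPoly = PolyOps ℚ.0ℚ ℚ.1ℚ ℚ._+_ ℚ._*_ (λ a → a ℚP.≟ ℚ.0ℚ)

toℚPoly : Poly → ℚPoly.Poly
toℚPoly = map (λ z → z / 1)

-- f is irreducible over ℚ: f is non-constant, and whenever f = g·h in ℚ[x],
-- one of g, h is a constant (a unit, since f ≠ 0).
IrreducibleOverℚ : Poly → Set
IrreducibleOverℚ f =
  (¬ (deg f ≡ 0)) ×
  ((g h : ℚPoly.Poly) →
     ℚPoly.normalize (ℚPoly.mulP g h) ≡ ℚPoly.normalize (toℚPoly f) →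
     ℚPoly.deg g ≡ 0 ⊎ ℚPoly.deg h ≡ 0)

-- Every f ∈ M_S of degree n is monic with all coefficients of x, …, xⁿ⁻¹ even, and so is
-- f(x+1): squaring xⁿ + c₀ + (even terms) only adds the even cross term 2c₀xⁿ. For the constant
-- terms, a² ≡ 0 or 1 (mod 4) according to the parity of a, so after the first generator one of
-- f(0), f(1) is ≡ 2 (mod 4) and the other is odd. This gives the Eisenstein statements, and
-- irreducibility follows from the Eisenstein argument for f or f(x+1): clearing denominators
-- turns a factorisation over ℚ into N·F = G·H over ℤ; halving factors whose coefficients are
-- all even gives both G and H an odd coefficient, and the product of the first odd ones is an
-- odd coefficient of N·F, which must be the leading one. Hence N is odd while G(0) and H(0)
-- are even, against F(0) ≡ 2 (mod 4).

module Submission where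

import Defs
open import Algebra.Bundles using (CommutativeRing)
open import Algebra.Structures using (IsCommutativeRing)
import Algebra.Properties.CommutativeSemigroup as CommutativeSemigroupProperties
open import Data.Bool using (Bool; true; false)
open import Data.Empty using (⊥-elim)
import Data.Integer as ℤ
import Data.Integer.DivMod as ℤ
open import Data.Integer.Divisibility using (_∣_)
import Data.Integer.Divisibility.Signed as Signed
open Signed using (divides)
import Data.Integer.Properties as ℤ
open import Data.Integer.Tactic.RingSolver using (solve-∀)
open import Data.List using ([]; _∷_; [_]; _++_; length; applyUpTo)
open import Data.List.Properties using (length-applyUpTo; applyUpTo-∷ʳ)
open import Data.List.Relation.Unary.All using (All)
open import Data.List.Relation.Unary.All.Properties using (applyUpTo⁺₁)
open import Data.Nat as ℕ using (ℕ; zero; suc; _≤_; _<_; z≤n; s≤s; z<s; _∸_)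
import Data.Nat.Divisibility as ℕ
open import Data.Nat.Induction using (<-wellFounded)
import Data.Nat.Properties as ℕ
open import Data.Product using (Σ; Σ-syntax; _×_; _,_; proj₁; proj₂)
open import Data.Rational as ℚ using (ℚ)
import Data.Rational.Properties as ℚ
import Data.Rational.Unnormalised as ℚᵘ
import Data.Rational.Unnormalised.Properties as ℚᵘ
open import Data.Sum using (_⊎_; inj₁; inj₂; [_,_]′)
open import Function using (_∘_; case_of_)
open import Induction.WellFounded using (Acc; acc)
open import Level using (0ℓ)
open import Relation.Binary.Bundles using (Setoid)
open import Relation.Binary.Definitions using (tri<; tri≈; tri>)
open import Relation.Binary.PropositionalEquality hiding ([_])
import Relation.Binary.Reasoning.Setoid as SetoidReasoning
open import Relation.Nullary using (¬_; Dec; yes; no)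

-- Polynomial arithmetic over a commutative ring

module PolynomialAlgebra
  {A : Set} {plus times : A → A → A} {neg : A → A} {zero# one# : A}
  (isCommutativeRing : IsCommutativeRing _≡_ plus times neg zero# one#)
  (isZero? : (a : A) → Dec (a ≡ zero#)) where

  private
    ring : CommutativeRing 0ℓ 0ℓ
    ring = record { isCommutativeRing = isCommutativeRing }

  open CommutativeRing ring
    using ( _+_; _*_; 0#; 1#; +-identityˡ; +-identityʳ; *-identityˡ; *-identityʳ
          ; zeroˡ; zeroʳ; distribˡ; distribʳ; *-assoc
          ; +-commutativeSemigroup; *-commutativeSemigroup )
  open CommutativeSemigroupProperties +-commutativeSemigroup
    using () renaming (interchange to +-interchange; x∙yz≈y∙xz to +-leftComm)
  open CommutativeSemigroupProperties *-commutativeSemigroup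
    using () renaming (x∙yz≈y∙xz to *-leftComm)
  open Defs.PolyOps 0# 1# _+_ _*_ isZero?

  coeff : Poly → ℕ → A
  coeff []      _       = 0#
  coeff (a ∷ p) zero    = a
  coeff (a ∷ p) (suc k) = coeff p k

  ZeroAbove : (ℕ → A) → ℕ → Set
  ZeroAbove c d = ∀ k → d < k → c k ≡ 0#

  record HasDegree (c : ℕ → A) (d : ℕ) : Set where
    field
      leading≢0 : ¬ c d ≡ 0#
      zeroAbove : ZeroAbove c d

  -- conv a b k = Σ_{i ≤ k} a i * b (k ∸ i)
  conv : (ℕ → A) → (ℕ → A) → ℕ → A
  conv a b zero    = a 0 * b 0
  conv a b (suc k) = a 0 * b (suc k) + conv (a ∘ suc) b k

  coeff-addP : ∀ p q k → coeff (addP p q) k ≡ coeff p k + coeff q k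
  coeff-addP []      q       k       = sym (+-identityˡ _)
  coeff-addP (a ∷ p) []      k       = sym (+-identityʳ _)
  coeff-addP (a ∷ p) (b ∷ q) zero    = refl
  coeff-addP (a ∷ p) (b ∷ q) (suc k) = coeff-addP p q k

  coeff-scaleP : ∀ a q k → coeff (scaleP a q) k ≡ a * coeff q k
  coeff-scaleP a []      k       = sym (zeroʳ a)
  coeff-scaleP a (b ∷ q) zero    = refl
  coeff-scaleP a (b ∷ q) (suc k) = coeff-scaleP a q k

  module _ (P : A → Set) (P0 : P 0#) (P+ : ∀ {x y} → P x → P y → P (x + y)) where

    conv-closed : ∀ a b k → (∀ i → i ≤ k → P (a i * b (k ∸ i))) → P (conv a b k)
    conv-closed a b zero    P-term = P-term 0 z≤n
    conv-closed a b (suc k) P-term =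
      P+ (P-term 0 z≤n) (conv-closed (a ∘ suc) b k (λ i i≤k → P-term (suc i) (s≤s i≤k)))

    conv-split : ∀ a b k i₀ → i₀ ≤ k → (∀ i → i ≤ k → i ≢ i₀ → P (a i * b (k ∸ i))) →
                 Σ[ r ∈ A ] P r × conv a b k ≡ a i₀ * b (k ∸ i₀) + r
    conv-split a b zero    zero    _         P-term = 0# , P0 , sym (+-identityʳ _)
    conv-split a b (suc k) zero    _         P-term =
      conv (a ∘ suc) b k , conv-closed (a ∘ suc) b k (λ i i≤k → P-term (suc i) (s≤s i≤k) λ ()) , refl
    conv-split a b (suc k) (suc j) (s≤s j≤k) P-term
      with conv-split (a ∘ suc) b k j j≤k (λ i i≤k i≢j → P-term (suc i) (s≤s i≤k) (i≢j ∘ ℕ.suc-injective))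
    ... | r , Pr , eq = a 0 * b (suc k) + r , P+ (P-term 0 z≤n λ ()) Pr ,
                        trans (cong (a 0 * b (suc k) +_) eq) (+-leftComm _ _ _)

  private
    sum≡0 : ∀ {x y} → x ≡ 0# → y ≡ 0# → x + y ≡ 0#
    sum≡0 refl refl = +-identityʳ 0#

  conv-zeroˡ : ∀ {a} b → (∀ i → a i ≡ 0#) → ∀ k → conv a b k ≡ 0#
  conv-zeroˡ b a≡0 k = conv-closed (_≡ 0#) refl sum≡0 _ b k
    (λ i _ → trans (cong (_* _) (a≡0 i)) (zeroˡ _))

  conv-zeroʳ : ∀ a {b} → (∀ i → b i ≡ 0#) → ∀ k → conv a b k ≡ 0#
  conv-zeroʳ a b≡0 k = conv-closed (_≡ 0#) refl sum≡0 a _ k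
    (λ i _ → trans (cong (a i *_) (b≡0 _)) (zeroʳ _))

  conv-cong : ∀ {a a′ b b′} → (∀ i → a i ≡ a′ i) → (∀ i → b i ≡ b′ i) →
              ∀ k → conv a b k ≡ conv a′ b′ k
  conv-cong a≡ b≡ zero    = cong₂ _*_ (a≡ 0) (b≡ 0)
  conv-cong a≡ b≡ (suc k) = cong₂ _+_ (cong₂ _*_ (a≡ 0) (b≡ (suc k))) (conv-cong (a≡ ∘ suc) b≡ k)

  conv-distribˡ : ∀ a b c k → conv (λ i → a i + b i) c k ≡ conv a c k + conv b c k
  conv-distribˡ a b c zero    = distribʳ (c 0) (a 0) (b 0)
  conv-distribˡ a b c (suc k) =
    trans (cong₂ _+_ (distribʳ (c (suc k)) (a 0) (b 0)) (conv-distribˡ (a ∘ suc) (b ∘ suc) c k))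
          (+-interchange _ _ _ _)

  conv-distribʳ : ∀ a b c k → conv a (λ i → b i + c i) k ≡ conv a b k + conv a c k
  conv-distribʳ a b c zero    = distribˡ (a 0) (b 0) (c 0)
  conv-distribʳ a b c (suc k) =
    trans (cong₂ _+_ (distribˡ (a 0) (b (suc k)) (c (suc k))) (conv-distribʳ (a ∘ suc) b c k))
          (+-interchange _ _ _ _)

  conv-scaleˡ : ∀ x a b k → conv (λ i → x * a i) b k ≡ x * conv a b k
  conv-scaleˡ x a b zero    = *-assoc x (a 0) (b 0)
  conv-scaleˡ x a b (suc k) =
    trans (cong₂ _+_ (*-assoc x (a 0) (b (suc k))) (conv-scaleˡ x (a ∘ suc) b k)) (sym (distribˡ x _ _))

  conv-scaleʳ : ∀ x a b k → conv a (λ i → x * b i) k ≡ x * conv a b k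
  conv-scaleʳ x a b zero    = *-leftComm (a 0) x (b 0)
  conv-scaleʳ x a b (suc k) =
    trans (cong₂ _+_ (*-leftComm (a 0) x (b (suc k))) (conv-scaleʳ x (a ∘ suc) b k)) (sym (distribˡ x _ _))

  conv-identityˡ : ∀ b k → conv (coeff [ 1# ]) b k ≡ b k
  conv-identityˡ b zero    = *-identityˡ (b 0)
  conv-identityˡ b (suc k) =
    trans (cong₂ _+_ (*-identityˡ (b (suc k))) (conv-zeroˡ b (λ _ → refl) k)) (+-identityʳ _)

  conv-identityʳ : ∀ a k → conv a (coeff [ 1# ]) k ≡ a k
  conv-identityʳ a zero    = *-identityʳ (a 0)
  conv-identityʳ a (suc k) =
    trans (cong₂ _+_ (zeroʳ (a 0)) (conv-identityʳ (a ∘ suc) k)) (+-identityˡ _)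

  coeff-mulP : ∀ p q k → coeff (mulP p q) k ≡ conv (coeff p) (coeff q) k
  coeff-mulP []      q k       = sym (conv-zeroˡ (coeff q) (λ _ → refl) k)
  coeff-mulP (a ∷ p) q zero    =
    trans (coeff-addP (scaleP a q) (0# ∷ mulP p q) 0) (trans (+-identityʳ _) (coeff-scaleP a q 0))
  coeff-mulP (a ∷ p) q (suc k) =
    trans (coeff-addP (scaleP a q) (0# ∷ mulP p q) (suc k))
          (cong₂ _+_ (coeff-scaleP a q (suc k)) (coeff-mulP p q k))

  conv-zeroAbove : ∀ {a b m n} → ZeroAbove a m → ZeroAbove b n → ZeroAbove (conv a b) (m ℕ.+ n)
  conv-zeroAbove {a} {b} {m} {n} za zb k m+n<k = conv-closed (_≡ 0#) refl sum≡0 a b k term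
    where
      term : ∀ i → i ≤ k → a i * b (k ∸ i) ≡ 0#
      term i _ with i ℕ.≤? m
      ... | yes i≤m = trans (cong (a i *_) (zb _ n<k∸i)) (zeroʳ _)
        where n<k∸i : n < k ∸ i
              n<k∸i = ℕ.m+n≤o⇒m≤o∸n (suc n) (ℕ.≤-trans (ℕ.+-monoʳ-≤ (suc n) i≤m)
                        (subst (_≤ k) (cong suc (ℕ.+-comm m n)) m+n<k))
      ... | no i≰m  = trans (cong (_* _) (za i (ℕ.≰⇒> i≰m))) (zeroˡ _)

  conv-leading : ∀ {a b m n} → ZeroAbove a m → ZeroAbove b n → conv a b (m ℕ.+ n) ≡ a m * b n
  conv-leading {a} {b} {m} {n} za zb
    with conv-split (_≡ 0#) refl sum≡0 a b (m ℕ.+ n) m (ℕ.m≤m+n m n) term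
    where
      term : ∀ i → i ≤ m ℕ.+ n → i ≢ m → a i * b (m ℕ.+ n ∸ i) ≡ 0#
      term i _ i≢m with ℕ.<-cmp i m
      ... | tri< i<m _ _ = trans (cong (a i *_) (zb _ n<m+n∸i)) (zeroʳ _)
        where n<m+n∸i : n < m ℕ.+ n ∸ i
              n<m+n∸i = subst (_< m ℕ.+ n ∸ i) (ℕ.m+n∸m≡n m n) (ℕ.∸-monoʳ-< i<m (ℕ.m≤m+n m n))
      ... | tri≈ _ i≡m _ = ⊥-elim (i≢m i≡m)
      ... | tri> _ _ m<i = trans (cong (_* _) (za i m<i)) (zeroˡ _)
  ... | _ , refl , eq = trans eq (trans (+-identityʳ _) (cong (λ j → a m * b j) (ℕ.m+n∸m≡n m n)))

  coeff-≥length : ∀ q k → length q ≤ k → coeff q k ≡ 0#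
  coeff-≥length []      k       _         = refl
  coeff-≥length (a ∷ q) (suc k) (s≤s q≤k) = coeff-≥length q k q≤k

  coeff-normalize : ∀ p k → coeff (normalize p) k ≡ coeff p k
  coeff-normalize []      k = refl
  coeff-normalize (a ∷ p) k with normalize p | coeff-normalize p
  ... | b ∷ r | ih = cons k
    where cons : ∀ k → coeff (a ∷ b ∷ r) k ≡ coeff (a ∷ p) k
          cons zero    = refl
          cons (suc k) = ih k
  ... | [] | ih with isZero? a
  ...   | yes a≡0 = nil k
    where nil : ∀ k → 0# ≡ coeff (a ∷ p) k
          nil zero    = sym a≡0
          nil (suc k) = ih k
  ...   | no _ = single k
    where single : ∀ k → coeff [ a ] k ≡ coeff (a ∷ p) k
          single zero    = refl
          single (suc k) = ih k

  normalize-last≢0 : ∀ p → normalize p ≡ [] ⊎ ¬ coeff (normalize p) (length (normalize p) ∸ 1) ≡ 0#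
  normalize-last≢0 []      = inj₁ refl
  normalize-last≢0 (a ∷ p) with normalize p | normalize-last≢0 p
  ... | b ∷ r | inj₂ last≢0 = inj₂ last≢0
  ... | [] | _ with isZero? a
  ...   | yes _   = inj₁ refl
  ...   | no a≢0 = inj₂ a≢0

  normalize-allZero : ∀ p → (∀ k → coeff p k ≡ 0#) → normalize p ≡ []
  normalize-allZero []      _    = refl
  normalize-allZero (a ∷ p) p≡0 with normalize p | normalize-allZero p (p≡0 ∘ suc)
  ... | _ | refl with isZero? a
  ...   | yes _   = refl
  ...   | no a≢0 = ⊥-elim (a≢0 (p≡0 0))

  normalize-hasDegree : ∀ p n → HasDegree (coeff p) n → normalize p ≡ applyUpTo (coeff p) (suc n)
  normalize-hasDegree []      n       d = ⊥-elim (HasDegree.leading≢0 d refl)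
  normalize-hasDegree (a ∷ p) zero    d
    with normalize p | normalize-allZero p (λ k → HasDegree.zeroAbove d (suc k) (s≤s z≤n))
  ... | _ | refl with isZero? a
  ...   | yes a≡0 = ⊥-elim (HasDegree.leading≢0 d a≡0)
  ...   | no _    = refl
  normalize-hasDegree (a ∷ p) (suc n) d
    with normalize p | normalize-hasDegree p n
           (record { leading≢0 = HasDegree.leading≢0 d
                   ; zeroAbove = λ k n<k → HasDegree.zeroAbove d (suc k) (s≤s n<k) })
  ... | _ | refl = refl

  deg-hasDegree : ∀ {p n} → HasDegree (coeff p) n → deg p ≡ n
  deg-hasDegree {p} {n} d =
    cong (_∸ 1) (trans (cong length (normalize-hasDegree p n d)) (length-applyUpTo (coeff p) (suc n)))

  hasDegree-deg : ∀ p → ¬ deg p ≡ 0 → HasDegree (coeff p) (deg p)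
  hasDegree-deg p deg≢0 = record
    { leading≢0 = leading≢0 (normalize-last≢0 p)
    ; zeroAbove = λ k deg<k → trans (sym (coeff-normalize p k))
                                    (coeff-≥length (normalize p) k (length≤ (length (normalize p)) deg<k))
    }
    where
      leading≢0 : normalize p ≡ [] ⊎ ¬ coeff (normalize p) (deg p) ≡ 0# → ¬ coeff p (deg p) ≡ 0#
      leading≢0 (inj₁ p≡[]) _   = deg≢0 (cong (λ l → length l ∸ 1) p≡[])
      leading≢0 (inj₂ ≢0)  ≡0 = ≢0 (trans (coeff-normalize p (deg p)) ≡0)
      length≤ : ∀ {k} l → l ∸ 1 < k → l ≤ k
      length≤ zero    _  = z≤n
      length≤ (suc l) lt = lt

  infix 4 _≈_
  record _≈_ (p q : Poly) : Set where
    constructor coeffwise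
    field coeff-≡ : ∀ k → coeff p k ≡ coeff q k
  open _≈_ public

  ≈-setoid : Setoid 0ℓ 0ℓ
  ≈-setoid = record
    { Carrier       = Poly
    ; _≈_           = _≈_
    ; isEquivalence = record
      { refl  = coeffwise λ _ → refl
      ; sym   = λ p≈q → coeffwise (sym ∘ coeff-≡ p≈q)
      ; trans = λ p≈q q≈r → coeffwise λ k → trans (coeff-≡ p≈q k) (coeff-≡ q≈r k)
      }
    }

  open Setoid ≈-setoid public using () renaming (refl to ≈-refl; sym to ≈-sym; trans to ≈-trans)
  module ≈-Reasoning = SetoidReasoning ≈-setoid

  ∷-cong : ∀ {a b p q} → a ≡ b → p ≈ q → (a ∷ p) ≈ (b ∷ q)
  ∷-cong a≡b p≈q = coeffwise λ { zero → a≡b ; (suc k) → coeff-≡ p≈q k }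

  addP-cong : ∀ {p p′ q q′} → p ≈ p′ → q ≈ q′ → addP p q ≈ addP p′ q′
  addP-cong {p} {p′} {q} {q′} p≈p′ q≈q′ = coeffwise λ k →
    trans (coeff-addP p q k) (trans (cong₂ _+_ (coeff-≡ p≈p′ k) (coeff-≡ q≈q′ k)) (sym (coeff-addP p′ q′ k)))

  mulP-cong : ∀ {p p′ q q′} → p ≈ p′ → q ≈ q′ → mulP p q ≈ mulP p′ q′
  mulP-cong {p} {p′} {q} {q′} p≈p′ q≈q′ = coeffwise λ k →
    trans (coeff-mulP p q k) (trans (conv-cong (coeff-≡ p≈p′) (coeff-≡ q≈q′) k) (sym (coeff-mulP p′ q′ k)))

  coeff-[0#] : ∀ k → coeff [ 0# ] k ≡ 0#
  coeff-[0#] zero    = refl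
  coeff-[0#] (suc k) = refl

  addP-congʳ : ∀ p {q q′} → q ≈ q′ → addP p q ≈ addP p q′
  addP-congʳ p = addP-cong (≈-refl {p})

  mulP-congʳ : ∀ p {q q′} → q ≈ q′ → mulP p q ≈ mulP p q′
  mulP-congʳ p = mulP-cong (≈-refl {p})

  addP-identityˡ : ∀ p → addP [ 0# ] p ≈ p
  addP-identityˡ p = coeffwise λ k →
    trans (coeff-addP [ 0# ] p k) (trans (cong (_+ coeff p k) (coeff-[0#] k)) (+-identityˡ _))

  addP-interchange : ∀ p q r s → addP (addP p q) (addP r s) ≈ addP (addP p r) (addP q s)
  addP-interchange p q r s = coeffwise λ k → begin
    coeff (addP (addP p q) (addP r s)) k
      ≡⟨ trans (coeff-addP (addP p q) (addP r s) k) (cong₂ _+_ (coeff-addP p q k) (coeff-addP r s k)) ⟩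
    (coeff p k + coeff q k) + (coeff r k + coeff s k) ≡⟨ +-interchange _ _ _ _ ⟩
    (coeff p k + coeff r k) + (coeff q k + coeff s k)
      ≡⟨ sym (trans (coeff-addP (addP p r) (addP q s) k) (cong₂ _+_ (coeff-addP p r k) (coeff-addP q s k))) ⟩
    coeff (addP (addP p r) (addP q s)) k            ∎
    where open ≡-Reasoning

  scaleP-addP : ∀ a p q → scaleP a (addP p q) ≈ addP (scaleP a p) (scaleP a q)
  scaleP-addP a p q = coeffwise λ k → begin
    coeff (scaleP a (addP p q)) k
      ≡⟨ trans (coeff-scaleP a (addP p q) k) (cong (a *_) (coeff-addP p q k)) ⟩
    a * (coeff p k + coeff q k)             ≡⟨ distribˡ a _ _ ⟩
    a * coeff p k + a * coeff q k
      ≡⟨ sym (trans (coeff-addP (scaleP a p) (scaleP a q) k) (cong₂ _+_ (coeff-scaleP a p k) (coeff-scaleP a q k))) ⟩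
    coeff (addP (scaleP a p) (scaleP a q)) k ∎
    where open ≡-Reasoning

  mulP-zeroʳ : ∀ p → mulP p [] ≈ []
  mulP-zeroʳ p = coeffwise λ k → trans (coeff-mulP p [] k) (conv-zeroʳ (coeff p) (λ _ → refl) k)

  mulP-constˡ : ∀ a p → mulP [ a ] p ≈ scaleP a p
  mulP-constˡ a p = coeffwise λ k →
    trans (coeff-addP (scaleP a p) [ 0# ] k) (trans (cong (coeff (scaleP a p) k +_) (coeff-[0#] k)) (+-identityʳ _))

  mulP-identityʳ : ∀ p → mulP p [ 1# ] ≈ p
  mulP-identityʳ p = coeffwise λ k → trans (coeff-mulP p [ 1# ] k) (conv-identityʳ (coeff p) k)

  mulP-distribʳ : ∀ p q r → mulP (addP p q) r ≈ addP (mulP p r) (mulP q r)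
  mulP-distribʳ p q r = coeffwise λ k → begin
    coeff (mulP (addP p q) r) k
      ≡⟨ trans (coeff-mulP (addP p q) r k) (conv-cong (coeff-addP p q) (λ _ → refl) k) ⟩
    conv (λ i → coeff p i + coeff q i) (coeff r) k
      ≡⟨ conv-distribˡ (coeff p) (coeff q) (coeff r) k ⟩
    conv (coeff p) (coeff r) k + conv (coeff q) (coeff r) k
      ≡⟨ sym (trans (coeff-addP (mulP p r) (mulP q r) k) (cong₂ _+_ (coeff-mulP p r k) (coeff-mulP q r k))) ⟩
    coeff (addP (mulP p r) (mulP q r)) k ∎
    where open ≡-Reasoning

  mulP-distribˡ : ∀ p q r → mulP p (addP q r) ≈ addP (mulP p q) (mulP p r)
  mulP-distribˡ p q r = coeffwise λ k → begin
    coeff (mulP p (addP q r)) k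
      ≡⟨ trans (coeff-mulP p (addP q r) k) (conv-cong (λ _ → refl) (coeff-addP q r) k) ⟩
    conv (coeff p) (λ i → coeff q i + coeff r i) k
      ≡⟨ conv-distribʳ (coeff p) (coeff q) (coeff r) k ⟩
    conv (coeff p) (coeff q) k + conv (coeff p) (coeff r) k
      ≡⟨ sym (trans (coeff-addP (mulP p q) (mulP p r) k) (cong₂ _+_ (coeff-mulP p q k) (coeff-mulP p r k))) ⟩
    coeff (addP (mulP p q) (mulP p r)) k ∎
    where open ≡-Reasoning

  mulP-scaleˡ : ∀ a q r → mulP (scaleP a q) r ≈ scaleP a (mulP q r)
  mulP-scaleˡ a q r = coeffwise λ k → begin
    coeff (mulP (scaleP a q) r) k
      ≡⟨ trans (coeff-mulP (scaleP a q) r k) (conv-cong (coeff-scaleP a q) (λ _ → refl) k) ⟩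
    conv (λ i → a * coeff q i) (coeff r) k   ≡⟨ conv-scaleˡ a (coeff q) (coeff r) k ⟩
    a * conv (coeff q) (coeff r) k
      ≡⟨ sym (trans (coeff-scaleP a (mulP q r) k) (cong (a *_) (coeff-mulP q r k))) ⟩
    coeff (scaleP a (mulP q r)) k ∎
    where open ≡-Reasoning

  mulP-scaleʳ : ∀ a q r → mulP q (scaleP a r) ≈ scaleP a (mulP q r)
  mulP-scaleʳ a q r = coeffwise λ k → begin
    coeff (mulP q (scaleP a r)) k
      ≡⟨ trans (coeff-mulP q (scaleP a r) k) (conv-cong (λ _ → refl) (coeff-scaleP a r) k) ⟩
    conv (coeff q) (λ i → a * coeff r i) k   ≡⟨ conv-scaleʳ a (coeff q) (coeff r) k ⟩
    a * conv (coeff q) (coeff r) k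
      ≡⟨ sym (trans (coeff-scaleP a (mulP q r) k) (cong (a *_) (coeff-mulP q r k))) ⟩
    coeff (scaleP a (mulP q r)) k ∎
    where open ≡-Reasoning

  mulP-0∷ˡ : ∀ p r → mulP (0# ∷ p) r ≈ (0# ∷ mulP p r)
  mulP-0∷ˡ p r = coeffwise λ k →
    trans (coeff-addP (scaleP 0# r) (0# ∷ mulP p r) k)
          (trans (cong (_+ coeff (0# ∷ mulP p r) k) (trans (coeff-scaleP 0# r k) (zeroˡ _))) (+-identityˡ _))

  mulP-assoc : ∀ p q r → mulP (mulP p q) r ≈ mulP p (mulP q r)
  mulP-assoc []      q r = ≈-refl
  mulP-assoc (a ∷ p) q r = begin
    mulP (addP (scaleP a q) (0# ∷ mulP p q)) r               ≈⟨ mulP-distribʳ (scaleP a q) (0# ∷ mulP p q) r ⟩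
    addP (mulP (scaleP a q) r) (mulP (0# ∷ mulP p q) r)
      ≈⟨ addP-cong (mulP-scaleˡ a q r) (mulP-0∷ˡ (mulP p q) r) ⟩
    addP (scaleP a (mulP q r)) (0# ∷ mulP (mulP p q) r)
      ≈⟨ addP-congʳ (scaleP a (mulP q r)) (∷-cong refl (mulP-assoc p q r)) ⟩
    addP (scaleP a (mulP q r)) (0# ∷ mulP p (mulP q r))      ∎
    where open ≈-Reasoning

  compP-≈[] : ∀ p q → p ≈ [] → compP p q ≈ []
  compP-≈[] []      q _  = ≈-refl
  compP-≈[] (b ∷ p) q b∷p≈[] = begin
    addP [ b ] (mulP q (compP p q))
      ≈⟨ addP-cong (∷-cong (coeff-≡ b∷p≈[] 0) (≈-refl {[]})) (mulP-congʳ q p∘q≈[]) ⟩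
    addP [ 0# ] (mulP q [])         ≈⟨ addP-identityˡ (mulP q []) ⟩
    mulP q []                       ≈⟨ mulP-zeroʳ q ⟩
    []                              ∎
    where
      open ≈-Reasoning
      p∘q≈[] : compP p q ≈ []
      p∘q≈[] = compP-≈[] p q (coeffwise (coeff-≡ b∷p≈[] ∘ suc))

  compP-congˡ : ∀ {p p′} q → p ≈ p′ → compP p q ≈ compP p′ q
  compP-congˡ {[]}    {[]}     q _    = ≈-refl
  compP-congˡ {[]}    {b ∷ p′} q p≈p′ = ≈-sym (compP-≈[] (b ∷ p′) q (≈-sym p≈p′))
  compP-congˡ {a ∷ p} {[]}     q p≈p′ = compP-≈[] (a ∷ p) q p≈p′
  compP-congˡ {a ∷ p} {b ∷ p′} q p≈p′ =
    addP-cong (∷-cong (coeff-≡ p≈p′ 0) (≈-refl {[]}))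
              (mulP-congʳ q (compP-congˡ {p} {p′} q (coeffwise (coeff-≡ p≈p′ ∘ suc))))

  compP-const : ∀ c q → compP [ c ] q ≈ [ c ]
  compP-const c q = addP-congʳ [ c ] (mulP-zeroʳ q)

  compP-identityˡ : ∀ q → compP X q ≈ q
  compP-identityˡ q = begin
    addP [ 0# ] (mulP q (compP [ 1# ] q)) ≈⟨ addP-identityˡ (mulP q (compP [ 1# ] q)) ⟩
    mulP q (compP [ 1# ] q)               ≈⟨ mulP-congʳ q (compP-const 1# q) ⟩
    mulP q [ 1# ]                         ≈⟨ mulP-identityʳ q ⟩
    q                                     ∎
    where open ≈-Reasoning

  compP-addP : ∀ p p′ q → compP (addP p p′) q ≈ addP (compP p q) (compP p′ q)
  compP-addP []      p′       q = ≈-refl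
  compP-addP (a ∷ p) []       q = coeffwise λ k → sym (trans (coeff-addP (compP (a ∷ p) q) [] k) (+-identityʳ _))
  compP-addP (a ∷ p) (b ∷ p′) q = begin
    addP [ a + b ] (mulP q (compP (addP p p′) q))
      ≈⟨ addP-congʳ [ a + b ] (mulP-congʳ q (compP-addP p p′ q)) ⟩
    addP (addP [ a ] [ b ]) (mulP q (addP (compP p q) (compP p′ q)))
      ≈⟨ addP-congʳ [ a + b ] (mulP-distribˡ q (compP p q) (compP p′ q)) ⟩
    addP (addP [ a ] [ b ]) (addP (mulP q (compP p q)) (mulP q (compP p′ q)))
      ≈⟨ addP-interchange [ a ] [ b ] (mulP q (compP p q)) (mulP q (compP p′ q)) ⟩
    addP (compP (a ∷ p) q) (compP (b ∷ p′) q) ∎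
    where open ≈-Reasoning

  compP-scaleP : ∀ a p q → compP (scaleP a p) q ≈ scaleP a (compP p q)
  compP-scaleP a []      q = ≈-refl
  compP-scaleP a (b ∷ p) q = begin
    addP (scaleP a [ b ]) (mulP q (compP (scaleP a p) q))
      ≈⟨ addP-congʳ (scaleP a [ b ]) (mulP-congʳ q (compP-scaleP a p q)) ⟩
    addP (scaleP a [ b ]) (mulP q (scaleP a (compP p q)))
      ≈⟨ addP-congʳ (scaleP a [ b ]) (mulP-scaleʳ a q (compP p q)) ⟩
    addP (scaleP a [ b ]) (scaleP a (mulP q (compP p q)))
      ≈⟨ ≈-sym (scaleP-addP a [ b ] (mulP q (compP p q))) ⟩
    scaleP a (compP (b ∷ p) q) ∎
    where open ≈-Reasoning

  compP-mulP : ∀ p r q → compP (mulP p r) q ≈ mulP (compP p q) (compP r q)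
  compP-mulP []      r q = ≈-refl
  compP-mulP (a ∷ p) r q = begin
    compP (addP (scaleP a r) (0# ∷ mulP p r)) q
      ≈⟨ compP-addP (scaleP a r) (0# ∷ mulP p r) q ⟩
    addP (compP (scaleP a r) q) (addP [ 0# ] (mulP q (compP (mulP p r) q)))
      ≈⟨ addP-cong (compP-scaleP a r q) (addP-identityˡ (mulP q (compP (mulP p r) q))) ⟩
    addP (scaleP a (compP r q)) (mulP q (compP (mulP p r) q))
      ≈⟨ addP-cong (≈-sym (mulP-constˡ a (compP r q))) (mulP-congʳ q (compP-mulP p r q)) ⟩
    addP (mulP [ a ] (compP r q)) (mulP q (mulP (compP p q) (compP r q)))
      ≈⟨ addP-congʳ (mulP [ a ] (compP r q)) (≈-sym (mulP-assoc q (compP p q) (compP r q))) ⟩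
    addP (mulP [ a ] (compP r q)) (mulP (mulP q (compP p q)) (compP r q))
      ≈⟨ ≈-sym (mulP-distribʳ [ a ] (mulP q (compP p q)) (compP r q)) ⟩
    mulP (compP (a ∷ p) q) (compP r q) ∎
    where open ≈-Reasoning

  compP-assoc : ∀ p f q → compP (compP p f) q ≈ compP p (compP f q)
  compP-assoc []      f q = ≈-refl
  compP-assoc (a ∷ p) f q = begin
    compP (addP [ a ] (mulP f (compP p f))) q
      ≈⟨ compP-addP [ a ] (mulP f (compP p f)) q ⟩
    addP (compP [ a ] q) (compP (mulP f (compP p f)) q)
      ≈⟨ addP-cong (compP-const a q) (compP-mulP f (compP p f) q) ⟩
    addP [ a ] (mulP (compP f q) (compP (compP p f) q))
      ≈⟨ addP-congʳ [ a ] (mulP-congʳ (compP f q) (compP-assoc p f q)) ⟩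
    compP (a ∷ p) (compP f q) ∎
    where open ≈-Reasoning

  compP-square : ∀ c f → compP (c ∷ 0# ∷ 1# ∷ []) f ≈ addP [ c ] (mulP f f)
  compP-square c f = addP-congʳ [ c ] (mulP-congʳ f (compP-identityˡ f))

  1+X : Poly
  1+X = 1# ∷ 1# ∷ []

  shift : Poly → Poly
  shift p = compP p 1+X

  coeff-shift-∷ : ∀ a p k → coeff (shift (a ∷ p)) (suc k) ≡ coeff (shift p) (suc k) + coeff (shift p) k
  coeff-shift-∷ a p k = begin
    coeff (addP [ a ] (mulP 1+X (shift p))) (suc k)
      ≡⟨ trans (coeff-addP [ a ] (mulP 1+X (shift p)) (suc k)) (+-identityˡ _) ⟩
    coeff (mulP 1+X (shift p)) (suc k)
      ≡⟨ coeff-mulP 1+X (shift p) (suc k) ⟩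
    1# * coeff (shift p) (suc k) + conv (coeff [ 1# ]) (coeff (shift p)) k
      ≡⟨ cong₂ _+_ (*-identityˡ _) (conv-identityˡ (coeff (shift p)) k) ⟩
    coeff (shift p) (suc k) + coeff (shift p) k ∎
    where open ≡-Reasoning

  shift-zeroAbove : ∀ p d → ZeroAbove (coeff p) d →
                    ZeroAbove (coeff (shift p)) d × coeff (shift p) d ≡ coeff p d
  shift-zeroAbove []      d       _  = (λ _ _ → refl) , refl
  shift-zeroAbove (a ∷ p) zero    za = (λ { (suc k) _ → coeff-≡ const (suc k) }) , coeff-≡ const 0
    where
      const : shift (a ∷ p) ≈ [ a ]
      const = addP-congʳ [ a ] (≈-trans (mulP-congʳ 1+X (compP-≈[] p 1+X (coeffwise λ k → za (suc k) z<s)))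
                                        (mulP-zeroʳ 1+X))
  shift-zeroAbove (a ∷ p) (suc d) za = above , leading
    where
      ih = shift-zeroAbove p d (λ k d<k → za (suc k) (s≤s d<k))
      above : ZeroAbove (coeff (shift (a ∷ p))) (suc d)
      above (suc k) (s≤s d<k) =
        trans (coeff-shift-∷ a p k) (sum≡0 (proj₁ ih (suc k) (ℕ.m<n⇒m<1+n d<k)) (proj₁ ih k d<k))
      leading : coeff (shift (a ∷ p)) (suc d) ≡ coeff p d
      leading = trans (coeff-shift-∷ a p d) (trans (cong₂ _+_ (proj₁ ih (suc d) (ℕ.n<1+n d)) (proj₂ ih)) (+-identityˡ _))

  hasDegree-shift : ∀ p {d} → HasDegree (coeff p) d → HasDegree (coeff (shift p)) d
  hasDegree-shift p {d} h = record
    { leading≢0 = HasDegree.leading≢0 h ∘ trans (sym (proj₂ shifted))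
    ; zeroAbove = proj₁ shifted }
    where shifted = shift-zeroAbove p d (HasDegree.zeroAbove h)

open Defs
open import Data.Integer using (ℤ; +_; _+_; _-_; _*_; ∣_∣)

module ℤ[X] = PolynomialAlgebra ℤ.+-*-isCommutativeRing (λ a → a ℤ.≟ + 0)
open ℤ[X] using (coeff; conv; ZeroAbove; HasDegree; _≈_; coeffwise; coeff-≡)

-- Parity and residues modulo 4

Even : ℤ → Set
Even x = + 2 Signed.∣ x

Odd : ℤ → Set
Odd x = Σ[ q ∈ ℤ ] x ≡ q * + 2 + + 1

TwoMod4 : ℤ → Set
TwoMod4 x = Σ[ q ∈ ℤ ] x ≡ q * + 4 + + 2

even-or-odd : ∀ x → Even x ⊎ Odd x
even-or-odd x with x ℤ.%ℕ 2 | ℤ.n%ℕd<d x 2 | ℤ.a≡a%ℕn+[a/ℕn]*n x 2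
... | 0 | _ | eq = inj₁ (divides (x ℤ./ℕ 2) (trans eq (ℤ.+-identityˡ _)))
... | 1 | _ | eq = inj₂ (x ℤ./ℕ 2 , trans eq (ℤ.+-comm (+ 1) ((x ℤ./ℕ 2) * + 2)))
... | suc (suc _) | s≤s (s≤s ()) | _

even⇒¬odd : ∀ {x} → Even x → ¬ Odd x
even⇒¬odd (divides q x≡2q) (r , x≡2r+1) = 2≢1 (ℕ.∣1⇒≡1 (Signed.∣⇒∣ᵤ 2∣1))
  where
    2∣1 : + 2 Signed.∣ + 1
    2∣1 = Signed.∣m+n∣m⇒∣n (divides q (trans (sym x≡2r+1) x≡2q)) (divides r refl)
    2≢1 : ¬ 2 ≡ 1
    2≢1 ()

even-zero : Even (+ 0)
even-zero = divides (+ 0) refl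

odd-* : ∀ {x y} → Odd x → Odd y → Odd (x * y)
odd-* (q , refl) (r , refl) = q * r * + 2 + q + r , lemma q r
  where lemma : ∀ q r → (q * + 2 + + 1) * (r * + 2 + + 1) ≡ (q * r * + 2 + q + r) * + 2 + + 1
        lemma = solve-∀

odd-+-even : ∀ {x y} → Odd x → Even y → Odd (x + y)
odd-+-even (q , refl) (divides r refl) = q + r , lemma q r
  where lemma : ∀ q r → q * + 2 + + 1 + r * + 2 ≡ (q + r) * + 2 + + 1
        lemma = solve-∀

twoMod4⇒even : ∀ {x} → TwoMod4 x → Even x
twoMod4⇒even (q , refl) = divides (q * + 2 + + 1) (lemma q)
  where lemma : ∀ q → q * + 4 + + 2 ≡ (q * + 2 + + 1) * + 2
        lemma = solve-∀

twoMod4⇒4∤ : ∀ {x} → TwoMod4 x → ¬ + 4 ∣ x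
twoMod4⇒4∤ (q , refl) 4∣x with Signed.∣ᵤ⇒∣ {+ 4} 4∣x
... | divides r eq = even⇒¬odd (divides r refl) (q , half)
  where
    l₁ : ∀ r → r * + 2 * + 2 ≡ r * + 4
    l₁ = solve-∀
    l₂ : ∀ q → q * + 4 + + 2 ≡ (q * + 2 + + 1) * + 2
    l₂ = solve-∀
    half : r * + 2 ≡ q * + 2 + + 1
    half = ℤ.*-cancelʳ-≡ _ _ (+ 2) (trans (l₁ r) (trans (sym eq) (l₂ q)))

even⇒2∣ : ∀ {x} → Even x → + 2 ∣ x
even⇒2∣ = Signed.∣⇒∣ᵤ

4∣x-2⇒twoMod4 : ∀ {x} → + 4 ∣ x - + 2 → TwoMod4 x
4∣x-2⇒twoMod4 {x} 4∣x-2 with Signed.∣ᵤ⇒∣ {+ 4} {x - + 2} 4∣x-2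
... | divides q eq = q , trans (lemma x) (cong (_+ + 2) eq)
  where lemma : ∀ x → x ≡ x - + 2 + + 2
        lemma = solve-∀

4∣x±1⇒odd : ∀ {x} → (+ 4 ∣ x - + 1) ⊎ (+ 4 ∣ x + + 1) → Odd x
4∣x±1⇒odd {x} (inj₁ 4∣x-1) with Signed.∣ᵤ⇒∣ {+ 4} {x - + 1} 4∣x-1
... | divides q eq = q * + 2 , trans (lemma x) (trans (cong (_+ + 1) eq) (lemma′ q))
  where lemma : ∀ x → x ≡ x - + 1 + + 1
        lemma = solve-∀
        lemma′ : ∀ q → q * + 4 + + 1 ≡ q * + 2 * + 2 + + 1
        lemma′ = solve-∀
4∣x±1⇒odd {x} (inj₂ 4∣x+1) with Signed.∣ᵤ⇒∣ {+ 4} {x + + 1} 4∣x+1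
... | divides q eq = q * + 2 - + 1 , trans (lemma x) (trans (cong (_- + 1) eq) (lemma′ q))
  where lemma : ∀ x → x ≡ x + + 1 - + 1
        lemma = solve-∀
        lemma′ : ∀ q → q * + 4 - + 1 ≡ (q * + 2 - + 1) * + 2 + + 1
        lemma′ = solve-∀

even*even≢odd*twoMod4 : ∀ {a b N c} → Even a → Even b → Odd N → TwoMod4 c → a * b ≢ N * c
even*even≢odd*twoMod4 {N = N} (divides a refl) (divides b refl) oddN (q , refl) ab≡Nc =
  even⇒¬odd (divides (a * b) refl) (subst Odd halves (odd-* oddN (q , refl)))
  where
    lhs : ∀ a b → a * + 2 * (b * + 2) ≡ a * b * + 2 * + 2
    lhs = solve-∀
    rhs : ∀ N q → N * (q * + 4 + + 2) ≡ N * (q * + 2 + + 1) * + 2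
    rhs = solve-∀
    halves : N * (q * + 2 + + 1) ≡ a * b * + 2
    halves = ℤ.*-cancelʳ-≡ _ _ (+ 2) (trans (sym (rhs N q)) (trans (sym ab≡Nc) (lhs a b)))

-- Monic polynomials with even middle coefficients

record EvenMonic (n : ℕ) (F : ℕ → ℤ) : Set where
  field
    1≤n        : 1 ≤ n
    leading    : F n ≡ + 1
    zeroAbove  : ZeroAbove F n
    evenMiddle : ∀ k → 0 < k → k < n → Even (F k)

  even-nonLeading : ∀ k → 0 < k → k ≢ n → Even (F k)
  even-nonLeading k 0<k k≢n with ℕ.<-cmp k n
  ... | tri< k<n _ _ = evenMiddle k 0<k k<n
  ... | tri≈ _ k≡n _ = ⊥-elim (k≢n k≡n)
  ... | tri> _ _ n<k = divides (+ 0) (zeroAbove k n<k)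

hasDegree-evenMonic : ∀ {n F} → EvenMonic n F → HasDegree F n
hasDegree-evenMonic monic = record
  { leading≢0 = λ F≡0 → case trans (sym leading) F≡0 of λ ()
  ; zeroAbove = zeroAbove
  }
  where open EvenMonic monic

deg-evenMonic : ∀ {f n} → EvenMonic n (coeff f) → deg f ≡ n
deg-evenMonic {f} = ℤ[X].deg-hasDegree {f} ∘ hasDegree-evenMonic

even-except-leading : ∀ {n F} → EvenMonic n F → Even (F 0) → ∀ k → k ≢ n → Even (F k)
even-except-leading monic even₀ zero    _   = even₀
even-except-leading monic even₀ (suc k) k≢n = EvenMonic.even-nonLeading monic (suc k) z<s k≢n

eisenstein-at-2 : ∀ {f n} → EvenMonic n (coeff f) → TwoMod4 (coeff f 0) → Eisenstein (+ 2) f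
eisenstein-at-2 {n = zero} record { 1≤n = () }
eisenstein-at-2 {f} {suc m} monic f₀ =
  coeff f 0 , applyUpTo (coeff f ∘ suc) m , coeff f (suc m) ,
  normal-form , 2∤leading , even⇒2∣ (twoMod4⇒even f₀) , 2∣middle , 4∤f₀
  where
    open EvenMonic monic
    normal-form : normalize f ≡ (coeff f 0 ∷ applyUpTo (coeff f ∘ suc) m) ++ [ coeff f (suc m) ]
    normal-form = trans (ℤ[X].normalize-hasDegree f (suc m) (hasDegree-evenMonic monic))
                        (cong (coeff f 0 ∷_) (sym (applyUpTo-∷ʳ (coeff f ∘ suc) m)))
    2∤leading : ¬ + 2 ∣ coeff f (suc m)
    2∤leading 2∣ with ℕ.∣1⇒≡1 (subst (+ 2 ∣_) leading 2∣)
    ... | ()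
    2∣middle : All (+ 2 ∣_) (applyUpTo (coeff f ∘ suc) m)
    2∣middle = applyUpTo⁺₁ (coeff f ∘ suc) m (λ i<m → even⇒2∣ (evenMiddle _ z<s (s≤s i<m)))
    4∤f₀ : ¬ (+ 2 * + 2) ∣ coeff f 0
    4∤f₀ = twoMod4⇒4∤ f₀

-- Integer factorisations and the Eisenstein argument at 2

-- A factorisation over ℚ with its denominators cleared: scale · f = left · right.
record Factorisation (f : Poly) : Set where
  field
    scale        : ℤ
    left right   : Poly
    degˡ degʳ    : ℕ
    1≤degˡ       : 1 ≤ degˡ
    1≤degʳ       : 1 ≤ degʳ
    left-degree  : HasDegree (coeff left) degˡ
    right-degree : HasDegree (coeff right) degʳ
    product      : mulP left right ≈ ℤPoly.scaleP scale f

  product-coeff : ∀ k → conv (coeff left) (coeff right) k ≡ scale * coeff f k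
  product-coeff k = trans (sym (ℤ[X].coeff-mulP left right k))
                          (trans (coeff-≡ product k) (ℤ[X].coeff-scaleP scale f k))

factorisation-bound : ∀ {f n} → ZeroAbove (coeff f) n → (φ : Factorisation f) →
                      Factorisation.degˡ φ ℕ.+ Factorisation.degʳ φ ≤ n × Factorisation.scale φ ≢ + 0
factorisation-bound {f} {n} zeroAbove φ = bound , scale≢0
  where
    open Factorisation φ
    d = degˡ ℕ.+ degʳ
    leading≢0 : scale * coeff f d ≢ + 0
    leading≢0 eq with ℤ.i*j≡0⇒i≡0∨j≡0 (coeff left degˡ) leading-product≡0
      where leading-product≡0 = trans (sym (ℤ[X].conv-leading (HasDegree.zeroAbove left-degree)
                                                                (HasDegree.zeroAbove right-degree)))
                                      (trans (product-coeff d) eq)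
    ... | inj₁ ≡0 = HasDegree.leading≢0 left-degree ≡0
    ... | inj₂ ≡0 = HasDegree.leading≢0 right-degree ≡0
    scale≢0 : scale ≢ + 0
    scale≢0 refl = leading≢0 refl
    bound : d ≤ n
    bound with d ℕ.≤? n
    ... | yes d≤n = d≤n
    ... | no  d≰n = ⊥-elim (leading≢0 (trans (cong (scale *_) (zeroAbove d (ℕ.≰⇒> d≰n))) (ℤ.*-zeroʳ scale)))

linear-unfactorisable : ∀ {f} → ZeroAbove (coeff f) 1 → ¬ Factorisation f
linear-unfactorisable zeroAbove φ =
  ℕ.<-irrefl refl (ℕ.≤-trans (ℕ.+-mono-≤ 1≤degˡ 1≤degʳ) (proj₁ (factorisation-bound zeroAbove φ)))
  where open Factorisation φ

halve : (p : Poly) → (∀ i → Even (coeff p i)) → Poly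
halve []      _    = []
halve (a ∷ p) even = Signed.quotient (even 0) ∷ halve p (even ∘ suc)

halve-≈ : ∀ p even → p ≈ ℤPoly.scaleP (+ 2) (halve p even)
halve-≈ []      _    = ℤ[X].≈-refl
halve-≈ (a ∷ p) even =
  ℤ[X].∷-cong (trans (Signed._∣_.equality (even 0)) (ℤ.*-comm _ (+ 2))) (halve-≈ p (even ∘ suc))

coeff-double : ∀ {p p′} → p ≈ ℤPoly.scaleP (+ 2) p′ → ∀ k → coeff p k ≡ + 2 * coeff p′ k
coeff-double {p′ = p′} p≈2p′ k = trans (coeff-≡ p≈2p′ k) (ℤ[X].coeff-scaleP (+ 2) p′ k)

hasDegree-half : ∀ {p p′ d} → p ≈ ℤPoly.scaleP (+ 2) p′ → HasDegree (coeff p) d → HasDegree (coeff p′) d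
hasDegree-half {p′ = p′} {d} p≈2p′ p-degree = record
  { leading≢0 = λ p′≡0 → HasDegree.leading≢0 p-degree (trans (coeff-double p≈2p′ d) (cong (+ 2 *_) p′≡0))
  ; zeroAbove = λ k d<k → ℤ.*-cancelˡ-≡ (+ 2) _ _
                  (trans (sym (coeff-double p≈2p′ k)) (HasDegree.zeroAbove p-degree k d<k))
  }

halve-product : ∀ {f n N p p′} → coeff f n ≡ + 1 → p ≈ ℤPoly.scaleP N f → p ≈ ℤPoly.scaleP (+ 2) p′ →
                N ≡ + 2 * coeff p′ n × p′ ≈ ℤPoly.scaleP (coeff p′ n) f
halve-product {f} {n} {N} {p} {p′} monic p≈Nf p≈2p′ = N≡2N′ , coeffwise p′≡N′f
  where
    N′ = coeff p′ n
    coeff-Nf : ∀ k → coeff p k ≡ N * coeff f k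
    coeff-Nf k = trans (coeff-≡ p≈Nf k) (ℤ[X].coeff-scaleP N f k)
    N≡2N′ : N ≡ + 2 * N′
    N≡2N′ = begin
      N                ≡⟨ sym (ℤ.*-identityʳ N) ⟩
      N * + 1          ≡⟨ cong (N *_) (sym monic) ⟩
      N * coeff f n    ≡⟨ sym (coeff-Nf n) ⟩
      coeff p n        ≡⟨ coeff-double p≈2p′ n ⟩
      + 2 * N′         ∎
      where open ≡-Reasoning
    p′≡N′f : ∀ k → coeff p′ k ≡ coeff (ℤPoly.scaleP N′ f) k
    p′≡N′f k = trans (ℤ.*-cancelˡ-≡ (+ 2) _ _ (begin
      + 2 * coeff p′ k        ≡⟨ sym (coeff-double p≈2p′ k) ⟩
      coeff p k               ≡⟨ coeff-Nf k ⟩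
      N * coeff f k           ≡⟨ cong (_* coeff f k) N≡2N′ ⟩
      + 2 * N′ * coeff f k    ≡⟨ ℤ.*-assoc (+ 2) N′ (coeff f k) ⟩
      + 2 * (N′ * coeff f k)  ∎)) (sym (ℤ[X].coeff-scaleP N′ f k))
      where open ≡-Reasoning

∣half∣<∣·∣ : ∀ {N M} → N ≡ + 2 * M → N ≢ + 0 → ∣ M ∣ ℕ.< ∣ N ∣
∣half∣<∣·∣ {M = M} refl 2M≢0 = subst (∣ M ∣ ℕ.<_) (sym (ℤ.abs-* (+ 2) M)) (ℕ.m<m+n ∣ M ∣ 0<∣M∣+0)
  where 0<∣M∣+0 : 0 ℕ.< ∣ M ∣ ℕ.+ 0
        0<∣M∣+0 = subst (0 ℕ.<_) (sym (ℕ.+-identityʳ ∣ M ∣))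
                    (ℕ.n≢0⇒n>0 (λ ∣M∣≡0 → 2M≢0 (cong (+ 2 *_) (ℤ.∣i∣≡0⇒i≡0 ∣M∣≡0))))

module _ {f : Poly} {n : ℕ} (monic : coeff f n ≡ + 1)
         (φ : Factorisation f) (scale≢0 : Factorisation.scale φ ≢ + 0) where
  open Factorisation φ

  halveˡ : (∀ i → Even (coeff left i)) → Σ[ ψ ∈ Factorisation f ] ∣ Factorisation.scale ψ ∣ ℕ.< ∣ scale ∣
  halveˡ even = ψ , ∣half∣<∣·∣ (proj₁ halved) scale≢0
    where
      left≈ = halve-≈ left even
      halved = halve-product monic product
                 (ℤ[X].≈-trans (ℤ[X].mulP-cong left≈ (ℤ[X].≈-refl {right}))
                               (ℤ[X].mulP-scaleˡ (+ 2) (halve left even) right))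
      ψ : Factorisation f
      ψ = record φ { scale = coeff (mulP (halve left even) right) n ; left = halve left even
                   ; left-degree = hasDegree-half left≈ left-degree ; product = proj₂ halved }

  halveʳ : (∀ i → Even (coeff right i)) → Σ[ ψ ∈ Factorisation f ] ∣ Factorisation.scale ψ ∣ ℕ.< ∣ scale ∣
  halveʳ even = ψ , ∣half∣<∣·∣ (proj₁ halved) scale≢0
    where
      right≈ = halve-≈ right even
      halved = halve-product monic product
                 (ℤ[X].≈-trans (ℤ[X].mulP-congʳ left right≈) (ℤ[X].mulP-scaleʳ (+ 2) left (halve right even)))
      ψ : Factorisation f
      ψ = record φ { scale = coeff (mulP left (halve right even)) n ; right = halve right even
                   ; right-degree = hasDegree-half right≈ right-degree ; product = proj₂ halved }

FirstOdd : (ℕ → ℤ) → ℕ → Set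
FirstOdd G d = Σ[ i ∈ ℕ ] i ≤ d × Odd (G i) × (∀ j → j ℕ.< i → Even (G j))

allEven-or-firstOdd : ∀ G d → (∀ i → i ≤ d → Even (G i)) ⊎ FirstOdd G d
allEven-or-firstOdd G zero with even-or-odd (G 0)
... | inj₁ even = inj₁ λ { zero z≤n → even }
... | inj₂ odd  = inj₂ (0 , z≤n , odd , λ _ ())
allEven-or-firstOdd G (suc d) with allEven-or-firstOdd G d
... | inj₂ (i , i≤d , odd , below) = inj₂ (i , ℕ.m≤n⇒m≤1+n i≤d , odd , below)
... | inj₁ allEven with even-or-odd (G (suc d))
...   | inj₂ odd  = inj₂ (suc d , ℕ.≤-refl , odd , λ j j≤d → allEven j (ℕ.≤-pred j≤d))
...   | inj₁ even = inj₁ λ i i≤1+d → [ (λ i≤d → allEven i (ℕ.≤-pred i≤d)) , (λ { refl → even }) ]′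
                                       (ℕ.m≤n⇒m<n∨m≡n i≤1+d)

allEven : ∀ {G d} → ZeroAbove G d → (∀ i → i ≤ d → Even (G i)) → ∀ i → Even (G i)
allEven {d = d} zeroAbove even i with i ℕ.≤? d
... | yes i≤d = even i i≤d
... | no  i≰d = divides (+ 0) (zeroAbove i (ℕ.≰⇒> i≰d))

Primitive : ∀ {f} → Factorisation f → Set
Primitive φ = FirstOdd (coeff left) degˡ × FirstOdd (coeff right) degʳ
  where open Factorisation φ

make-primitive : ∀ {f n} → coeff f n ≡ + 1 → ZeroAbove (coeff f) n →
                 Factorisation f → Σ (Factorisation f) Primitive
make-primitive {f} monic zeroAbove φ = descend φ (<-wellFounded _)
  where
    descend : (φ : Factorisation f) → Acc ℕ._<_ ∣ Factorisation.scale φ ∣ → Σ (Factorisation f) Primitive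
    descend φ (acc smaller) =
      step (allEven-or-firstOdd (coeff left) degˡ) (allEven-or-firstOdd (coeff right) degʳ)
      where
        open Factorisation φ
        scale≢0 = proj₂ (factorisation-bound zeroAbove φ)
        step : (∀ i → i ≤ degˡ → Even (coeff left i)) ⊎ FirstOdd (coeff left) degˡ →
               (∀ i → i ≤ degʳ → Even (coeff right i)) ⊎ FirstOdd (coeff right) degʳ →
               Σ (Factorisation f) Primitive
        step (inj₁ evenˡ) _ =
          let ψ , ψ<φ = halveˡ monic φ scale≢0 (allEven (HasDegree.zeroAbove left-degree) evenˡ)
          in descend ψ (smaller ψ<φ)
        step (inj₂ _) (inj₁ evenʳ) =
          let ψ , ψ<φ = halveʳ monic φ scale≢0 (allEven (HasDegree.zeroAbove right-degree) evenʳ)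
          in descend ψ (smaller ψ<φ)
        step (inj₂ oddˡ) (inj₂ oddʳ) = φ , oddˡ , oddʳ

conv-odd : ∀ G H i j → Odd (G i) → (∀ i′ → i′ ℕ.< i → Even (G i′)) →
                       Odd (H j) → (∀ j′ → j′ ℕ.< j → Even (H j′)) → Odd (conv G H (i ℕ.+ j))
conv-odd G H i j oddG evenG oddH evenH
  with ℤ[X].conv-split Even even-zero Signed.∣m∣n⇒∣m+n G H (i ℕ.+ j) i (ℕ.m≤m+n i j) even-term
  where
    even-term : ∀ i′ → i′ ≤ i ℕ.+ j → i′ ≢ i → Even (G i′ * H (i ℕ.+ j ∸ i′))
    even-term i′ i′≤i+j i′≢i with ℕ.<-cmp i′ i
    ... | tri< i′<i _ _ = Signed.∣m⇒∣m*n _ (evenG i′ i′<i)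
    ... | tri≈ _ i′≡i _ = ⊥-elim (i′≢i i′≡i)
    ... | tri> _ _ i<i′ = Signed.∣n⇒∣m*n (G i′) (evenH _ (subst (i ℕ.+ j ∸ i′ ℕ.<_) (ℕ.m+n∸m≡n i j)
                                                            (ℕ.∸-monoʳ-< i<i′ i′≤i+j)))
... | r , even-r , eq =
  subst Odd (sym eq) (odd-+-even (subst (λ k → Odd (G i * H k)) (sym (ℕ.m+n∸m≡n i j)) (odd-* oddG oddH)) even-r)

eisenstein-unfactorisable : ∀ {f n} → EvenMonic n (coeff f) → TwoMod4 (coeff f 0) → ¬ Factorisation f
eisenstein-unfactorisable {f} {n} monic f₀ φ₀
  with make-primitive (EvenMonic.leading monic) (EvenMonic.zeroAbove monic) φ₀
... | φ , (i , i≤degˡ , oddˡ , evenˡ) , (j , j≤degʳ , oddʳ , evenʳ) =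
  even*even≢odd*twoMod4 (evenˡ 0 0<i) (evenʳ 0 0<j) odd-scale f₀ (product-coeff 0)
  where
    open EvenMonic monic
    open Factorisation φ
    odd-coefficient : Odd (scale * coeff f (i ℕ.+ j))
    odd-coefficient =
      subst Odd (product-coeff (i ℕ.+ j)) (conv-odd (coeff left) (coeff right) i j oddˡ evenˡ oddʳ evenʳ)
    i+j≡n : i ℕ.+ j ≡ n
    i+j≡n with i ℕ.+ j ℕ.≟ n
    ... | yes i+j≡n = i+j≡n
    ... | no  i+j≢n = ⊥-elim (even⇒¬odd (Signed.∣n⇒∣m*n scale
                                (even-except-leading monic (twoMod4⇒even f₀) _ i+j≢n)) odd-coefficient)
    odd-scale : Odd scale
    odd-scale = subst Odd (trans (cong (λ k → scale * coeff f k) i+j≡n)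
                                 (trans (cong (scale *_) leading) (ℤ.*-identityʳ scale))) odd-coefficient
    degrees≤i+j : degˡ ℕ.+ degʳ ≤ i ℕ.+ j
    degrees≤i+j = subst (degˡ ℕ.+ degʳ ≤_) (sym i+j≡n) (proj₁ (factorisation-bound zeroAbove φ))
    0<i : 0 ℕ.< i
    0<i = ℕ.≤-trans 1≤degˡ (ℕ.+-cancelʳ-≤ degʳ degˡ i (ℕ.≤-trans degrees≤i+j (ℕ.+-monoʳ-≤ i j≤degʳ)))
    0<j : 0 ℕ.< j
    0<j = ℕ.≤-trans 1≤degʳ (ℕ.+-cancelˡ-≤ degˡ degʳ j (ℕ.≤-trans degrees≤i+j (ℕ.+-monoˡ-≤ j i≤degˡ)))

factorisation-shift : ∀ {f} → Factorisation f → Factorisation (shift1 f)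
factorisation-shift {f} φ = record
  { scale        = scale
  ; left         = ℤ[X].shift left
  ; right        = ℤ[X].shift right
  ; left-degree  = ℤ[X].hasDegree-shift left left-degree
  ; degˡ         = degˡ
  ; degʳ         = degʳ
  ; 1≤degˡ       = 1≤degˡ
  ; 1≤degʳ       = 1≤degʳ
  ; right-degree = ℤ[X].hasDegree-shift right right-degree
  ; product      = begin
      mulP (ℤ[X].shift left) (ℤ[X].shift right) ≈⟨ ℤ[X].≈-sym (ℤ[X].compP-mulP left right ℤ[X].1+X) ⟩
      compP (mulP left right) ℤ[X].1+X          ≈⟨ ℤ[X].compP-congˡ ℤ[X].1+X product ⟩
      compP (ℤPoly.scaleP scale f) ℤ[X].1+X     ≈⟨ ℤ[X].compP-scaleP scale f ℤ[X].1+X ⟩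
      ℤPoly.scaleP scale (shift1 f)             ∎
  }
  where
    open Factorisation φ
    open ℤ[X].≈-Reasoning

-- Clearing denominators

module ℚ[X] = PolynomialAlgebra ℚ.+-*-isCommutativeRing (λ a → a ℚ.≟ ℚ.0ℚ)

embed : ℤ → ℚ
embed z = z ℚ./ 1

embed-≃ : ∀ z → ℚ.toℚᵘ (embed z) ℚᵘ.≃ ℚᵘ.mkℚᵘ z 0
embed-≃ z = ℚ.toℚᵘ-fromℚᵘ (ℚᵘ.mkℚᵘ z 0)

embed-+ : ∀ a b → embed (a + b) ≡ embed a ℚ.+ embed b
embed-+ a b = ℚ.toℚᵘ-injective (begin
  ℚ.toℚᵘ (embed (a + b))                       ≈⟨ embed-≃ (a + b) ⟩
  ℚᵘ.mkℚᵘ (a + b) 0                            ≈⟨ ℚᵘ.*≡* (lemma a b) ⟩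
  ℚᵘ.mkℚᵘ a 0 ℚᵘ.+ ℚᵘ.mkℚᵘ b 0                 ≈⟨ ℚᵘ.+-cong (embed-≃ a) (embed-≃ b) ⟨
  ℚ.toℚᵘ (embed a) ℚᵘ.+ ℚ.toℚᵘ (embed b)       ≈⟨ ℚ.toℚᵘ-homo-+ (embed a) (embed b) ⟨
  ℚ.toℚᵘ (embed a ℚ.+ embed b)                 ∎)
  where
    open ℚᵘ.≃-Reasoning
    lemma : ∀ a b → (a + b) * (+ 1 * + 1) ≡ (a * + 1 + b * + 1) * + 1
    lemma = solve-∀

embed-* : ∀ a b → embed (a * b) ≡ embed a ℚ.* embed b
embed-* a b = ℚ.toℚᵘ-injective (begin
  ℚ.toℚᵘ (embed (a * b))                       ≈⟨ embed-≃ (a * b) ⟩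
  ℚᵘ.mkℚᵘ (a * b) 0                            ≈⟨ ℚᵘ.*≡* (lemma a b) ⟩
  ℚᵘ.mkℚᵘ a 0 ℚᵘ.* ℚᵘ.mkℚᵘ b 0                 ≈⟨ ℚᵘ.*-cong (embed-≃ a) (embed-≃ b) ⟨
  ℚ.toℚᵘ (embed a) ℚᵘ.* ℚ.toℚᵘ (embed b)       ≈⟨ ℚ.toℚᵘ-homo-* (embed a) (embed b) ⟨
  ℚ.toℚᵘ (embed a ℚ.* embed b)                 ∎)
  where
    open ℚᵘ.≃-Reasoning
    lemma : ∀ a b → a * b * (+ 1 * + 1) ≡ a * b * + 1
    lemma = solve-∀

embed-injective : ∀ {a b} → embed a ≡ embed b → a ≡ b
embed-injective {a} {b} eq with ℚᵘ.≃-trans (ℚᵘ.≃-sym (embed-≃ a)) (ℚᵘ.≃-trans (ℚ.toℚᵘ-cong eq) (embed-≃ b))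
... | ℚᵘ.*≡* a*1≡b*1 = trans (sym (ℤ.*-identityʳ a)) (trans a*1≡b*1 (ℤ.*-identityʳ b))

embed-conv : ∀ a b k → embed (conv a b k) ≡ ℚ[X].conv (embed ∘ a) (embed ∘ b) k
embed-conv a b zero    = embed-* (a 0) (b 0)
embed-conv a b (suc k) = trans (embed-+ (a 0 * b (suc k)) (conv (a ∘ suc) b k))
                               (cong₂ ℚ._+_ (embed-* (a 0) (b (suc k))) (embed-conv (a ∘ suc) b k))

embed-numerator : ∀ q → q ℚ.* embed (ℚ.↧ q) ≡ embed (ℚ.↥ q)
embed-numerator q@(ℚ.mkℚ n d-1 _) = ℚ.toℚᵘ-injective (begin
  ℚ.toℚᵘ (q ℚ.* embed (ℚ.↧ q))                ≈⟨ ℚ.toℚᵘ-homo-* q (embed (ℚ.↧ q)) ⟩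
  ℚᵘ.mkℚᵘ n d-1 ℚᵘ.* ℚ.toℚᵘ (embed (ℚ.↧ q))    ≈⟨ ℚᵘ.*-congˡ {ℚᵘ.mkℚᵘ n d-1} (embed-≃ (ℚ.↧ q)) ⟩
  ℚᵘ.mkℚᵘ n d-1 ℚᵘ.* ℚᵘ.mkℚᵘ (ℚ.↧ q) 0         ≈⟨ ℚᵘ.*≡* (lemma n (ℚ.↧ q)) ⟩
  ℚᵘ.mkℚᵘ n 0                                  ≈⟨ embed-≃ n ⟨
  ℚ.toℚᵘ (embed n)                             ∎)
  where
    open ℚᵘ.≃-Reasoning
    lemma : ∀ n d → n * d * + 1 ≡ n * (d * + 1)
    lemma = solve-∀

ℚ-x*y≡0⇒y≡0 : ∀ {c x} → c ≢ ℚ.0ℚ → c ℚ.* x ≡ ℚ.0ℚ → x ≡ ℚ.0ℚ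
ℚ-x*y≡0⇒y≡0 {c} {x} c≢0 cx≡0 = begin
  x                        ≡⟨ sym (ℚ.*-identityˡ x) ⟩
  ℚ.1ℚ ℚ.* x               ≡⟨ cong (ℚ._* x) (sym (ℚ.*-inverseˡ c)) ⟩
  ℚ.1/ c ℚ.* c ℚ.* x       ≡⟨ ℚ.*-assoc (ℚ.1/ c) c x ⟩
  ℚ.1/ c ℚ.* (c ℚ.* x)     ≡⟨ cong (ℚ.1/ c ℚ.*_) cx≡0 ⟩
  ℚ.1/ c ℚ.* ℚ.0ℚ          ≡⟨ ℚ.*-zeroʳ (ℚ.1/ c) ⟩
  ℚ.0ℚ                     ∎
  where
    open ≡-Reasoning
    instance _ = ℚ.≢-nonZero c≢0

-- (D , G) with G = D · g over ℚ, D being the product of the denominators of g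
clearDenominators : ℚPoly.Poly → ℤ × Poly
clearDenominators []      = + 1 , []
clearDenominators (q ∷ g) = ℚ.↧ q * D , (ℚ.↥ q * D) ∷ ℤPoly.scaleP (ℚ.↧ q) G
  where
    D = proj₁ (clearDenominators g)
    G = proj₂ (clearDenominators g)

clearDenominators-scale≢0 : ∀ g → proj₁ (clearDenominators g) ≢ + 0
clearDenominators-scale≢0 []                     ()
clearDenominators-scale≢0 (ℚ.mkℚ _ d-1 _ ∷ g) eq with ℤ.i*j≡0⇒i≡0∨j≡0 (+ suc d-1) eq
... | inj₂ D≡0 = clearDenominators-scale≢0 g D≡0

clearDenominators-coeff : ∀ g k → let (D , G) = clearDenominators g in
                          embed (coeff G k) ≡ embed D ℚ.* ℚ[X].coeff g k
clearDenominators-coeff []      k       = sym (ℚ.*-zeroʳ (embed (+ 1)))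
clearDenominators-coeff (q ∷ g) zero    = begin
  embed (ℚ.↥ q * D)                        ≡⟨ embed-* (ℚ.↥ q) D ⟩
  embed (ℚ.↥ q) ℚ.* embed D                ≡⟨ cong (ℚ._* embed D) (sym (embed-numerator q)) ⟩
  q ℚ.* embed (ℚ.↧ q) ℚ.* embed D          ≡⟨ ℚ.*-comm (q ℚ.* embed (ℚ.↧ q)) (embed D) ⟩
  embed D ℚ.* (q ℚ.* embed (ℚ.↧ q))        ≡⟨ cong (embed D ℚ.*_) (ℚ.*-comm q (embed (ℚ.↧ q))) ⟩
  embed D ℚ.* (embed (ℚ.↧ q) ℚ.* q)        ≡⟨ sym (ℚ.*-assoc (embed D) (embed (ℚ.↧ q)) q) ⟩
  embed D ℚ.* embed (ℚ.↧ q) ℚ.* q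
    ≡⟨ cong (ℚ._* q) (trans (ℚ.*-comm (embed D) _) (sym (embed-* (ℚ.↧ q) D))) ⟩
  embed (ℚ.↧ q * D) ℚ.* q                  ∎
  where
    open ≡-Reasoning
    D = proj₁ (clearDenominators g)
clearDenominators-coeff (q ∷ g) (suc k) = begin
  embed (coeff (ℤPoly.scaleP (ℚ.↧ q) G) k)      ≡⟨ cong embed (ℤ[X].coeff-scaleP (ℚ.↧ q) G k) ⟩
  embed (ℚ.↧ q * coeff G k)                    ≡⟨ embed-* (ℚ.↧ q) (coeff G k) ⟩
  embed (ℚ.↧ q) ℚ.* embed (coeff G k)          ≡⟨ cong (embed (ℚ.↧ q) ℚ.*_) (clearDenominators-coeff g k) ⟩
  embed (ℚ.↧ q) ℚ.* (embed D ℚ.* ℚ[X].coeff g k) ≡⟨ sym (ℚ.*-assoc (embed (ℚ.↧ q)) (embed D) (ℚ[X].coeff g k)) ⟩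
  embed (ℚ.↧ q) ℚ.* embed D ℚ.* ℚ[X].coeff g k ≡⟨ cong (ℚ._* ℚ[X].coeff g k) (sym (embed-* (ℚ.↧ q) D)) ⟩
  embed (ℚ.↧ q * D) ℚ.* ℚ[X].coeff g k         ∎
  where
    open ≡-Reasoning
    D = proj₁ (clearDenominators g)
    G = proj₂ (clearDenominators g)

hasDegree-clearDenominators : ∀ g {d} → ℚ[X].HasDegree (ℚ[X].coeff g) d →
                              HasDegree (coeff (proj₂ (clearDenominators g))) d
hasDegree-clearDenominators g {d} g-degree = record
  { leading≢0 = λ G≡0 → ℚ[X].HasDegree.leading≢0 g-degree
                          (ℚ-x*y≡0⇒y≡0 D≢0 (trans (sym (coeff-embed d)) (cong embed G≡0)))
  ; zeroAbove = λ k d<k → embed-injective (trans (coeff-embed k)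
                  (trans (cong (embed D ℚ.*_) (ℚ[X].HasDegree.zeroAbove g-degree k d<k)) (ℚ.*-zeroʳ (embed D))))
  }
  where
    D = proj₁ (clearDenominators g)
    coeff-embed = clearDenominators-coeff g
    D≢0 : embed D ≢ ℚ.0ℚ
    D≢0 = clearDenominators-scale≢0 g ∘ embed-injective

coeff-toℚPoly : ∀ f k → ℚ[X].coeff (toℚPoly f) k ≡ embed (coeff f k)
coeff-toℚPoly []      k       = refl
coeff-toℚPoly (a ∷ f) zero    = refl
coeff-toℚPoly (a ∷ f) (suc k) = coeff-toℚPoly f k

clearDenominators-product : ∀ f g h → ℚPoly.normalize (ℚPoly.mulP g h) ≡ ℚPoly.normalize (toℚPoly f) →
  let (Dg , G) = clearDenominators g ; (Dh , H) = clearDenominators h in mulP G H ≈ ℤPoly.scaleP (Dg * Dh) f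
clearDenominators-product f g h gh≡f = coeffwise λ k → embed-injective (begin
  embed (coeff (mulP G H) k)                                   ≡⟨ cong embed (ℤ[X].coeff-mulP G H k) ⟩
  embed (conv (coeff G) (coeff H) k)                           ≡⟨ embed-conv (coeff G) (coeff H) k ⟩
  ℚ[X].conv (embed ∘ coeff G) (embed ∘ coeff H) k
    ≡⟨ ℚ[X].conv-cong (clearDenominators-coeff g) (clearDenominators-coeff h) k ⟩
  ℚ[X].conv (λ i → embed Dg ℚ.* ℚ[X].coeff g i) (λ i → embed Dh ℚ.* ℚ[X].coeff h i) k
    ≡⟨ trans (ℚ[X].conv-scaleˡ (embed Dg) (ℚ[X].coeff g) _ k)
             (cong (embed Dg ℚ.*_) (ℚ[X].conv-scaleʳ (embed Dh) (ℚ[X].coeff g) (ℚ[X].coeff h) k)) ⟩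
  embed Dg ℚ.* (embed Dh ℚ.* ℚ[X].conv (ℚ[X].coeff g) (ℚ[X].coeff h) k)
    ≡⟨ cong (λ x → embed Dg ℚ.* (embed Dh ℚ.* x)) gh≡f-coeff ⟩
  embed Dg ℚ.* (embed Dh ℚ.* embed (coeff f k))
    ≡⟨ sym (trans (embed-* (Dg * Dh) (coeff f k))
                  (trans (cong (ℚ._* embed (coeff f k)) (embed-* Dg Dh)) (ℚ.*-assoc (embed Dg) (embed Dh) _))) ⟩
  embed (Dg * Dh * coeff f k)
    ≡⟨ cong embed (sym (ℤ[X].coeff-scaleP (Dg * Dh) f k)) ⟩
  embed (coeff (ℤPoly.scaleP (Dg * Dh) f) k)                   ∎)
  where
    open ≡-Reasoning
    Dg = proj₁ (clearDenominators g)
    G  = proj₂ (clearDenominators g)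
    Dh = proj₁ (clearDenominators h)
    H  = proj₂ (clearDenominators h)
    gh≡f-coeff : ∀ {k} → ℚ[X].conv (ℚ[X].coeff g) (ℚ[X].coeff h) k ≡ embed (coeff f k)
    gh≡f-coeff {k} = begin
      ℚ[X].conv (ℚ[X].coeff g) (ℚ[X].coeff h) k        ≡⟨ sym (ℚ[X].coeff-mulP g h k) ⟩
      ℚ[X].coeff (ℚPoly.mulP g h) k                    ≡⟨ sym (ℚ[X].coeff-normalize (ℚPoly.mulP g h) k) ⟩
      ℚ[X].coeff (ℚPoly.normalize (ℚPoly.mulP g h)) k  ≡⟨ cong (λ p → ℚ[X].coeff p k) gh≡f ⟩
      ℚ[X].coeff (ℚPoly.normalize (toℚPoly f)) k        ≡⟨ ℚ[X].coeff-normalize (toℚPoly f) k ⟩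
      ℚ[X].coeff (toℚPoly f) k                          ≡⟨ coeff-toℚPoly f k ⟩
      embed (coeff f k)                                ∎

irreducible-if-unfactorisable : ∀ {f} → deg f ≢ 0 → ¬ Factorisation f → IrreducibleOverℚ f
irreducible-if-unfactorisable {f} deg≢0 unfactorisable = deg≢0 , constant-factor
  where
    constant-factor : ∀ g h → ℚPoly.normalize (ℚPoly.mulP g h) ≡ ℚPoly.normalize (toℚPoly f) →
                      ℚPoly.deg g ≡ 0 ⊎ ℚPoly.deg h ≡ 0
    constant-factor g h gh≡f with ℚPoly.deg g ℕ.≟ 0 | ℚPoly.deg h ℕ.≟ 0
    ... | yes g-constant | _              = inj₁ g-constant
    ... | no _           | yes h-constant = inj₂ h-constant
    ... | no g≢0         | no h≢0         = ⊥-elim (unfactorisable record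
      { scale        = proj₁ (clearDenominators g) * proj₁ (clearDenominators h)
      ; left         = proj₂ (clearDenominators g)
      ; right        = proj₂ (clearDenominators h)
      ; degˡ         = ℚPoly.deg g
      ; degʳ         = ℚPoly.deg h
      ; 1≤degˡ       = ℕ.n≢0⇒n>0 g≢0
      ; 1≤degʳ       = ℕ.n≢0⇒n>0 h≢0
      ; left-degree  = hasDegree-clearDenominators g (ℚ[X].hasDegree-deg g g≢0)
      ; right-degree = hasDegree-clearDenominators h (ℚ[X].hasDegree-deg h h≢0)
      ; product      = clearDenominators-product f g h gh≡f
      })

-- The elements of M_S

square-middle-even : ∀ {n c} → EvenMonic n c → Even (conv c c n)
square-middle-even {zero}  record { 1≤n = () }
square-middle-even {suc m} {c} monic
  with ℤ[X].conv-split Even even-zero Signed.∣m∣n⇒∣m+n (c ∘ suc) c m m ℕ.≤-refl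
         (λ i i≤m i≢m → Signed.∣m⇒∣m*n _ (EvenMonic.evenMiddle monic (suc i) z<s (s≤s (ℕ.≤∧≢⇒< i≤m i≢m))))
... | r , even-r , eq = subst Even (sym regroup) (Signed.∣m∣n⇒∣m+n cross even-r)
  where
    cross-lemma : ∀ x y → x * y + y * x ≡ x * y * + 2
    cross-lemma = solve-∀
    cross : Even (c 0 * c (suc m) + c (suc m) * c 0)
    cross = divides (c 0 * c (suc m)) (cross-lemma (c 0) (c (suc m)))
    regroup : conv c c (suc m) ≡ c 0 * c (suc m) + c (suc m) * c 0 + r
    regroup = trans (cong (λ t → c 0 * c (suc m) + t) (trans eq (cong (λ j → c (suc m) * c j + r) (ℕ.n∸n≡0 m))))
                    (sym (ℤ.+-assoc (c 0 * c (suc m)) (c (suc m) * c 0) r))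

square-coeff-even : ∀ {n c} → EvenMonic n c → ∀ k → 0 ℕ.< k → k ℕ.< n ℕ.+ n → Even (conv c c k)
square-coeff-even {n} {c} monic k 0<k k<2n with k ℕ.≟ n
... | yes refl = square-middle-even monic
... | no  k≢n  = ℤ[X].conv-closed Even even-zero Signed.∣m∣n⇒∣m+n c c k even-term
  where
    open EvenMonic monic
    even-term : ∀ i → i ≤ k → Even (c i * c (k ∸ i))
    even-term zero    _   = Signed.∣n⇒∣m*n (c 0) (even-nonLeading k 0<k k≢n)
    even-term (suc i) i≤k with suc i ℕ.≟ n
    ... | no  i≢n  = Signed.∣m⇒∣m*n _ (even-nonLeading (suc i) z<s i≢n)
    ... | yes refl = Signed.∣n⇒∣m*n (c n)
                       (even-nonLeading (k ∸ n) (ℕ.m<n⇒0<n∸m (ℕ.≤∧≢⇒< i≤k (k≢n ∘ sym)))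
                                                (ℕ.<⇒≢ (ℕ.m<n+o⇒m∸n<o k n k<2n)))

evenMonic-square : ∀ {n c c′} → EvenMonic n c → (∀ k → c′ (suc k) ≡ conv c c (suc k)) → EvenMonic (n ℕ.+ n) c′
evenMonic-square {zero}  record { 1≤n = () }
evenMonic-square {suc m} {c} {c′} monic c′≡c² = record
  { 1≤n        = z<s
  ; leading    = trans (c′≡c² (m ℕ.+ suc m))
                       (trans (ℤ[X].conv-leading zeroAbove zeroAbove) (cong₂ _*_ leading leading))
  ; zeroAbove  = λ { (suc k) 2n<k → trans (c′≡c² k) (ℤ[X].conv-zeroAbove zeroAbove zeroAbove (suc k) 2n<k) }
  ; evenMiddle = λ { (suc k) _ k<2n → subst Even (sym (c′≡c² k)) (square-coeff-even monic (suc k) z<s k<2n) }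
  }
  where open EvenMonic monic

data ConstantTerms (n : ℕ) (f₀ f₁ : ℤ) : Set where
  linear      : n ≡ 1 → Even f₀ → Odd f₁ → ConstantTerms n f₀ f₁
  twoMod4-odd : TwoMod4 f₀ → Odd f₁ → ConstantTerms n f₀ f₁
  odd-twoMod4 : Odd f₀ → TwoMod4 f₁ → ConstantTerms n f₀ f₁

opposite-parity : ∀ {n f₀ f₁} → ConstantTerms n f₀ f₁ → (Even f₀ × Odd f₁) ⊎ (Odd f₀ × Even f₁)
opposite-parity (linear _ even odd)      = inj₁ (even , odd)
opposite-parity (twoMod4-odd f₀ odd)     = inj₁ (twoMod4⇒even f₀ , odd)
opposite-parity (odd-twoMod4 odd f₁)     = inj₂ (odd , twoMod4⇒even f₁)

odd-f₀⇒twoMod4-f₁ : ∀ {n f₀ f₁} → ConstantTerms n f₀ f₁ → Odd f₀ → TwoMod4 f₁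
odd-f₀⇒twoMod4-f₁ (linear _ even _)  odd = ⊥-elim (even⇒¬odd even odd)
odd-f₀⇒twoMod4-f₁ (twoMod4-odd f₀ _) odd = ⊥-elim (even⇒¬odd (twoMod4⇒even f₀) odd)
odd-f₀⇒twoMod4-f₁ (odd-twoMod4 _ f₁) _   = f₁

genConstant : Bool → ℤ
genConstant true  = ℤ.- + 2
genConstant false = ℤ.- + 3

gen-square : ∀ b → gen b ≡ genConstant b ∷ + 0 ∷ + 1 ∷ []
gen-square true  = refl
gen-square false = refl

module _ (x : ℤ) where
  even-square-2 : Even x → TwoMod4 (ℤ.- + 2 + x * x)
  even-square-2 (divides q refl) = q * q - + 1 , lemma q
    where lemma : ∀ q → ℤ.- + 2 + q * + 2 * (q * + 2) ≡ (q * q - + 1) * + 4 + + 2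
          lemma = solve-∀

  odd-square-2 : Odd x → Odd (ℤ.- + 2 + x * x)
  odd-square-2 (q , refl) = q * q * + 2 + q * + 2 - + 1 , lemma q
    where lemma : ∀ q → ℤ.- + 2 + (q * + 2 + + 1) * (q * + 2 + + 1) ≡ (q * q * + 2 + q * + 2 - + 1) * + 2 + + 1
          lemma = solve-∀

  even-square-3 : Even x → Odd (ℤ.- + 3 + x * x)
  even-square-3 (divides q refl) = q * q * + 2 - + 2 , lemma q
    where lemma : ∀ q → ℤ.- + 3 + q * + 2 * (q * + 2) ≡ (q * q * + 2 - + 2) * + 2 + + 1
          lemma = solve-∀

  odd-square-3 : Odd x → TwoMod4 (ℤ.- + 3 + x * x)
  odd-square-3 (q , refl) = q * q + q - + 1 , lemma q
    where lemma : ∀ q → ℤ.- + 3 + (q * + 2 + + 1) * (q * + 2 + + 1) ≡ (q * q + q - + 1) * + 4 + + 2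
          lemma = solve-∀

constantTerms-step : ∀ b {n f₀ f₁} → ConstantTerms n f₀ f₁ →
                     ConstantTerms (n ℕ.+ n) (genConstant b + f₀ * f₀) (genConstant b + f₁ * f₁)
constantTerms-step b {f₀ = f₀} {f₁} constants with b | opposite-parity constants
... | true  | inj₁ (even , odd) = twoMod4-odd (even-square-2 f₀ even) (odd-square-2 f₁ odd)
... | true  | inj₂ (odd , even) = odd-twoMod4 (odd-square-2 f₀ odd) (even-square-2 f₁ even)
... | false | inj₁ (even , odd) = odd-twoMod4 (even-square-3 f₀ even) (odd-square-3 f₁ odd)
... | false | inj₂ (odd , even) = twoMod4-odd (odd-square-3 f₀ odd) (even-square-3 f₁ even)

coeff-compP-gen : ∀ b f k → coeff (compP (gen b) f) k ≡ coeff [ genConstant b ] k + conv (coeff f) (coeff f) k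
coeff-compP-gen b f k rewrite gen-square b = begin
  coeff (compP (genConstant b ∷ + 0 ∷ + 1 ∷ []) f) k         ≡⟨ coeff-≡ (ℤ[X].compP-square (genConstant b) f) k ⟩
  coeff (addP [ genConstant b ] (mulP f f)) k               ≡⟨ ℤ[X].coeff-addP [ genConstant b ] (mulP f f) k ⟩
  coeff [ genConstant b ] k + coeff (mulP f f) k
    ≡⟨ cong (λ t → coeff [ genConstant b ] k + t) (ℤ[X].coeff-mulP f f k) ⟩
  coeff [ genConstant b ] k + conv (coeff f) (coeff f) k    ∎
  where open ≡-Reasoning

coeff-shift-compP-gen : ∀ b f k → coeff (shift1 (compP (gen b) f)) k ≡
                                   coeff [ genConstant b ] k + conv (coeff (shift1 f)) (coeff (shift1 f)) k
coeff-shift-compP-gen b f k =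
  trans (coeff-≡ (ℤ[X].compP-assoc (gen b) f ℤ[X].1+X) k) (coeff-compP-gen b (shift1 f) k)

record Invariant (f : Poly) : Set where
  field
    degree    : ℕ
    shape     : EvenMonic degree (coeff f)
    shape₁    : EvenMonic degree (coeff (shift1 f))
    constants : ConstantTerms degree (coeff f 0) (coeff (shift1 f) 0)

invariant-X : Invariant Xℤ
invariant-X = record
  { degree    = 1
  ; shape     = record
    { 1≤n = ℕ.≤-refl ; leading = refl ; evenMiddle = λ { (suc k) _ (s≤s ()) }
    ; zeroAbove = λ { (suc zero) (s≤s ()) ; (suc (suc k)) _ → refl } }
  ; shape₁    = record
    { 1≤n = ℕ.≤-refl ; leading = refl ; evenMiddle = λ { (suc k) _ (s≤s ()) }
    ; zeroAbove = λ { (suc zero) (s≤s ()) ; (suc (suc k)) _ → zero-tail k } }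
  ; constants = linear refl even-zero (+ 0 , refl)
  }
  where
    zero-tail : ∀ k → coeff (shift1 Xℤ) (2 ℕ.+ k) ≡ + 0
    zero-tail zero    = refl
    zero-tail (suc k) = refl

invariant-step : ∀ b {f} → Invariant f → Invariant (compP (gen b) f)
invariant-step b {f} inv = record
  { degree    = degree ℕ.+ degree
  ; shape     = evenMonic-square shape (λ k → trans (coeff-compP-gen b f (suc k)) (ℤ.+-identityˡ _))
  ; shape₁    = evenMonic-square shape₁ (λ k → trans (coeff-shift-compP-gen b f (suc k)) (ℤ.+-identityˡ _))
  ; constants = subst₂ (ConstantTerms (degree ℕ.+ degree))
                       (sym (coeff-compP-gen b f 0)) (sym (coeff-shift-compP-gen b f 0))
                       (constantTerms-step b constants)
  }
  where open Invariant inv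

invariant : ∀ {f} → InMS f → Invariant f
invariant idMS          = invariant-X
invariant (compMS b f∈) = invariant-step b (invariant f∈)

at0≡coeff0 : ∀ f → at0 f ≡ coeff f 0
at0≡coeff0 []      = refl
at0≡coeff0 (_ ∷ _) = refl

lemma4p1 : (f : Poly) → InMS f →
    ((+ 4 ∣ (at0 f - + 2)) → Eisenstein (+ 2) f) ×
    (((+ 4 ∣ (at0 f - + 1)) ⊎ (+ 4 ∣ (at0 f + + 1))) → Eisenstein (+ 2) (shift1 f)) ×
    IrreducibleOverℚ f
lemma4p1 f f∈M rewrite at0≡coeff0 f = eisenstein-f , eisenstein-shift1-f , irreducible
  where
    open Invariant (invariant f∈M)
    eisenstein-f : + 4 ∣ coeff f 0 - + 2 → Eisenstein (+ 2) f
    eisenstein-f = eisenstein-at-2 {f} shape ∘ 4∣x-2⇒twoMod4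
    eisenstein-shift1-f : (+ 4 ∣ coeff f 0 - + 1) ⊎ (+ 4 ∣ coeff f 0 + + 1) → Eisenstein (+ 2) (shift1 f)
    eisenstein-shift1-f = eisenstein-at-2 {shift1 f} shape₁ ∘ odd-f₀⇒twoMod4-f₁ constants ∘ 4∣x±1⇒odd
    unfactorisable : ¬ Factorisation f
    unfactorisable with constants
    ... | linear degree≡1 _ _ =
      linear-unfactorisable (subst (ZeroAbove (coeff f)) degree≡1 (EvenMonic.zeroAbove shape))
    ... | twoMod4-odd f₀ _    = eisenstein-unfactorisable shape f₀
    ... | odd-twoMod4 _ f₁    = eisenstein-unfactorisable shape₁ f₁ ∘ factorisation-shift
    irreducible : IrreducibleOverℚ f
    irreducible = irreducible-if-unfactorisable
                    (λ deg≡0 → ℕ.<⇒≢ (EvenMonic.1≤n shape) (trans (sym deg≡0) (deg-evenMonic {f} shape)))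
                    unfactorisable
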